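{- Let $d=2$ and let $\sigma$ be a growth schedule (with graphs $G_0,\dots,G_k$) for a graph $G$. Let $u,w$ be vertices generated in slots $t_1\le t_2$ respectively, and let $\mathrm{dist}_t$ denote the distance between $u$ and $w$ in $G_t$. Then $\mathrm{dist}_t\ge \mathrm{dist}_{t_2}$ for every slot $t\ge t_2$.
   Context: Growth schedules with edge-activation distance $d$ (a fixed positive integer). A growth schedule of $k$ slots produces graphs $G_0,\dots,G_k$, where $G_0=(\{u_0\},\emptyset)$ is a single vertex. In slot $t$ the process sets $G_t=G_{t-1}$; for every $u\in V(G_{t-1})$ it may add at most one new vertex $u'$ (said to be generated in slot $t$) with the edge $uu'$ and any subset of the edges $\{vu' : v\in V(G_{t-1}),\ \mathrm{dist}_{G_{t-1}}(u,v)\le d-1\}$; finally it deletes any set of edges of $G_t$ whose deletion does not disconnect $G_t$; $G_t$ is the graph at the end of slot $t$. Deleted edges are excess edges. The schedule grows $G$ if $G_k\cong G$. -}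

module Defs where

open import Data.Nat using (ℕ; zero; suc; _≤_; _∸_)
open import Data.Product using (Σ; _×_; ∃)
open import Relation.Nullary using (¬_)
open import Relation.Binary.PropositionalEquality using (_≡_)

record Graph : Set₁ where
  field
    V     : ℕ → Set
    E     : ℕ → ℕ → Set
    E-sym : ∀ {x y} → E x y → E y x
    E-irr : ∀ {x} → ¬ E x x
    E-V   : ∀ {x y} → E x y → V x × V y
open Graph public

data Walk (G : Graph) : ℕ → ℕ → ℕ → Set where
  nil  : ∀ {x} → V G x → Walk G x x 0
  cons : ∀ {x y z n} → E G x y → Walk G y z n → Walk G x z (suc n)

IsDist : Graph → ℕ → ℕ → ℕ → Set
IsDist G x y n = Walk G x y n × (∀ m → Walk G x y m → n ≤ m)

DistLe : Graph → ℕ → ℕ → ℕ → Set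
DistLe G x y m = Σ ℕ λ l → l ≤ m × Walk G x y l

Connected : Graph → Set
Connected G = ∀ x y → V G x → V G y → Σ ℕ λ n → Walk G x y n

-- P = G_{t-1}, H = graph after adding the new vertices and activated edges
-- (before deletions), R = G_t (after deleting excess edges);
-- par y = the vertex u that generated the new vertex y = u'.
record Slot (d : ℕ) (P H R : Graph) (par : ℕ → ℕ) : Set where
  field
    old⊆H      : ∀ x → V P x → V H x
    H⊆R        : ∀ x → V H x → V R x
    R⊆H        : ∀ x → V R x → V H x
    parent-old : ∀ y → V H y → ¬ V P y → V P (par y)
    parent-edge : ∀ y → V H y → ¬ V P y → E H (par y) y
    parent-inj : ∀ y y' → V H y → ¬ V P y → V H y' → ¬ V P y' →
                 par y ≡ par y' → y ≡ y'
    old-edges⊆ : ∀ x y → E P x y → E H x y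
    old-edges⊇ : ∀ x y → V P x → V P y → E H x y → E P x y
    new-edges  : ∀ v y → E H v y → ¬ V P y →
                 V P v × DistLe P (par y) v (d ∸ 1)
    R-edges⊆   : ∀ x y → E R x y → E H x y
    R-conn     : Connected R

record Schedule (d : ℕ) : Set₁ where
  field
    k    : ℕ
    G    : ℕ → Graph
    H    : ℕ → Graph
    par  : ℕ → ℕ → ℕ
    u₀   : ℕ
    G₀-V : ∀ x → V (G 0) x → x ≡ u₀
    G₀-u : V (G 0) u₀
    G₀-E : ∀ x y → ¬ E (G 0) x y
    slot : ∀ s → suc s ≤ k → Slot d (G s) (H (suc s)) (G (suc s)) (par (suc s))
open Schedule public

Generated : ∀ {d} → Schedule d → ℕ → ℕ → Set
Generated σ zero    x = x ≡ u₀ σ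
Generated σ (suc t) x = V (G σ (suc t)) x × ¬ V (G σ t) x

-- A walk in G_t between two
-- vertices that already existed in G_{t-1} either uses an edge of G_{t-1} or
-- passes through a new vertex y; in the latter case both neighbours of y on the
-- walk lie within distance d - 1 ≤ 1 of the parent of y in G_{t-1}, so the
-- detour of length 2 through y can be replaced by one of length at most 2
-- through the parent.  Hence distances between old vertices never increase,
-- and iterating over the slots t₂ + 1, …, t gives the claim.
module Submission where

open import Defs
open import Data.Nat using (ℕ; zero; suc; _≤_; _+_; _∸_; z≤n; s≤s; _≤′_; ≤′-refl; ≤′-step; _≤?_)
open import Data.Nat.Properties using (≤-refl; ≤-trans; n≤1+n; +-mono-≤; ∸-monoˡ-≤; ≤⇒≤′)
open import Data.Product using (_,_; proj₁; proj₂)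
open import Data.Empty using (⊥-elim)
open import Effect.Monad using (RawMonad)
open import Level using (0ℓ)
open import Relation.Nullary using (¬_; yes; no)
open import Relation.Nullary.Negation using (DoubleNegation; ¬¬-Monad)
open import Relation.Nullary.Decidable using (¬¬-excluded-middle; decidable-stable)
open import Relation.Binary.PropositionalEquality using (sym; subst)

open RawMonad (¬¬-Monad {0ℓ}) using (_>>=_; _<$>_; pure)

private
  variable
    Γ : Graph
    x y z : ℕ
    m n : ℕ

Walk-snoc : Walk Γ x y n → E Γ y z → Walk Γ x z (suc n)
Walk-snoc {Γ} (nil _)    e = cons e (nil (proj₂ (E-V Γ e)))
Walk-snoc     (cons f w) e = cons f (Walk-snoc w e)

Walk-reverse : Walk Γ x y n → Walk Γ y x n
Walk-reverse     (nil v)    = nil v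
Walk-reverse {Γ} (cons e w) = Walk-snoc (Walk-reverse w) (E-sym Γ e)

Walk-append : Walk Γ x y m → Walk Γ y z n → Walk Γ x z (m + n)
Walk-append (nil _)    w′ = w′
Walk-append (cons e w) w′ = cons e (Walk-append w w′)

DistLe-sym : DistLe Γ x y n → DistLe Γ y x n
DistLe-sym (l , l≤n , w) = l , l≤n , Walk-reverse w

DistLe-trans : DistLe Γ x y m → DistLe Γ y z n → DistLe Γ x z (m + n)
DistLe-trans (l , l≤m , w) (l′ , l′≤n , w′) = l + l′ , +-mono-≤ l≤m l′≤n , Walk-append w w′

DistLe-mono : m ≤ n → DistLe Γ x y m → DistLe Γ x y n
DistLe-mono m≤n (l , l≤m , w) = l , ≤-trans l≤m m≤n , w

DistLe-step : E Γ x y → DistLe Γ y z n → DistLe Γ x z (suc n)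
DistLe-step e (l , l≤n , w) = suc l , s≤s l≤n , cons e w

IsDist-≤-DistLe : IsDist Γ x y m → DistLe Γ x y n → m ≤ n
IsDist-≤-DistLe (_ , minimal) (l , l≤n , w) = ≤-trans (minimal l w) l≤n

module SlotProperties {d} (d≤2 : d ≤ 2) {P H R : Graph} {par : ℕ → ℕ} (S : Slot d P H R par) where
  open Slot S

  old-vertex-persists : V P x → V R x
  old-vertex-persists {x} px = H⊆R x (old⊆H x px)

  new-vertex-neighbours-close : E H x y → E H y z → ¬ V P y → DistLe P x z 2
  new-vertex-neighbours-close {x} {y} {z} e e′ ¬py =
    DistLe-mono (+-mono-≤ d∸1≤1 d∸1≤1)
      (DistLe-trans (DistLe-sym (proj₂ (new-edges x y e ¬py)))
                    (proj₂ (new-edges z y (E-sym H e′) ¬py)))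
    where
      d∸1≤1 : d ∸ 1 ≤ 1
      d∸1≤1 = ∸-monoˡ-≤ 1 d≤2

  -- Whether a vertex is old is not decidable, hence the double negation.
  walk-shortcut : V P x → V P z → Walk R x z n → DoubleNegation (DistLe P x z n)
  walk-shortcut px pz (nil _) = pure (0 , z≤n , nil px)
  walk-shortcut {x} {z} px pz (cons {y = y} e w) = ¬¬-excluded-middle >>= λ where
      (yes py) → DistLe-step (old-edges⊇ x y px py (R-edges⊆ x y e)) <$> walk-shortcut py pz w
      (no ¬py) → detour ¬py w
    where
      detour : ¬ V P y → Walk R y z m → DoubleNegation (DistLe P x z (suc m))
      detour ¬py (nil _) = ⊥-elim (¬py pz)
      detour ¬py (cons {y = y′} e′ w′) =
        DistLe-trans (new-vertex-neighbours-close (R-edges⊆ x y e) (R-edges⊆ y y′ e′) ¬py)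
          <$> walk-shortcut (proj₁ (new-edges y′ y (E-sym H (R-edges⊆ y y′ e′)) ¬py)) pz w′

module ScheduleProperties {d} (d≤2 : d ≤ 2) (σ : Schedule d) where
  open SlotProperties d≤2

  vertex-persists : ∀ {s t} → s ≤′ t → t ≤ k σ → V (G σ s) x → V (G σ t) x
  vertex-persists ≤′-refl          _   v = v
  vertex-persists (≤′-step {t} s≤t) t<k v =
    old-vertex-persists (slot σ t t<k) (vertex-persists s≤t (≤-trans (n≤1+n t) t<k) v)

  distance-nonincreasing : ∀ {s t} → s ≤′ t → t ≤ k σ → V (G σ s) x → V (G σ s) y →
                           Walk (G σ t) x y n → DoubleNegation (DistLe (G σ s) x y n)
  distance-nonincreasing ≤′-refl           _   _  _  w = pure (_ , ≤-refl , w)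
  distance-nonincreasing {s = s} (≤′-step {t} s≤t) t<k px py w = do
    (l , l≤n , w′) ← walk-shortcut (slot σ t t<k) (persist px) (persist py) w
    DistLe-mono l≤n <$> distance-nonincreasing s≤t t≤k px py w′
    where
      t≤k = ≤-trans (n≤1+n t) t<k
      persist : V (G σ s) z → V (G σ t) z
      persist = vertex-persists s≤t t≤k

  generated-vertex : ∀ t → Generated σ t x → V (G σ t) x
  generated-vertex zero    x≡u₀       = subst (V (G σ 0)) (sym x≡u₀) (G₀-u σ)
  generated-vertex (suc t) (vx , _) = vx

mainTheorem19 : (σ : Schedule 2) (u w t₁ t₂ : ℕ) →
                t₁ ≤ t₂ → Generated σ t₁ u → Generated σ t₂ w →
                ∀ t → t₂ ≤ t → t ≤ k σ →
                ∀ a b → IsDist (G σ t) u w a → IsDist (G σ t₂) u w b → b ≤ a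
mainTheorem19 σ u w t₁ t₂ t₁≤t₂ gen-u gen-w t t₂≤t t≤k a b (walk-a , _) dist-b =
  decidable-stable (b ≤? a)
    (IsDist-≤-DistLe dist-b <$> distance-nonincreasing (≤⇒≤′ t₂≤t) t≤k u∈G₂ w∈G₂ walk-a)
  where
    open ScheduleProperties ≤-refl σ
    u∈G₂ = vertex-persists (≤⇒≤′ t₁≤t₂) (≤-trans t₂≤t t≤k) (generated-vertex t₁ gen-u)
    w∈G₂ = generated-vertex t₂ gen-w
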